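{- Let $3\leq r<k<\ell$ be integers. Then $\mathrm{ex}_k(n,\text{Berge- }P^{(r)}_\ell)=O(n^{r-1})$.
   Context: The tight path $P^{(r)}_\ell$ is the $r$-uniform hypergraph on vertices $v_1,\dots,v_\ell$ whose edges are the $\ell-r+1$ sets of $r$ consecutive vertices. For an $r$-uniform hypergraph $F$ and $k>r$, a $k$-uniform hypergraph $H$ is Berge-$F$ if there is a bijection $\phi:E(F)\to E(H)$ with $e\subseteq\phi(e)$ for all $e\in E(F)$ (with $V(F)$ identified with a subset of $V(H)$); $H$ contains a Berge-$F$ if some subhypergraph is Berge-$F$. $\mathrm{ex}_k(n,\text{Berge- }F)$ is the maximum number of hyperedges in a $k$-uniform hypergraph on $n$ vertices containing no Berge-$F$. -}

module Defs where

open import Data.Nat using (ℕ; _+_; _∸_; _≤_; _<_)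
open import Data.Fin using (Fin; toℕ)
open import Data.Fin.Subset using (Subset; _∈_; ∣_∣)
open import Data.List using (List; length; lookup)
open import Data.List.Relation.Unary.All using (All)
open import Data.List.Relation.Unary.Unique.Propositional using (Unique)
open import Data.Product using (Σ; _×_)
open import Relation.Binary.PropositionalEquality using (_≡_)
open import Function.Definitions using (Injective)

record UniformHypergraph (n k : ℕ) : Set where
  field
    edges    : List (Subset n)
    distinct : Unique edges
    uniform  : All (λ e → ∣ e ∣ ≡ k) edges

open UniformHypergraph public

numEdges : ∀ {n k} → UniformHypergraph n k → ℕ
numEdges H = length (edges H)

-- The tight path P^(r)_ℓ on vertices v_0..v_{ℓ-1} (0-indexed) has the
-- ℓ - r + 1 edges e_i = {v_i, ..., v_{i+r-1}}, i = 0..ℓ-r.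
-- Vertex j lies in edge i iff i ≤ j < i + r.
InTightPathEdge : (r ℓ : ℕ) → Fin (ℓ ∸ r + 1) → Fin ℓ → Set
InTightPathEdge r ℓ i j = (toℕ i ≤ toℕ j) × (toℕ j < toℕ i + r)

-- H contains a Berge-P^(r)_ℓ: an injective identification of the path's
-- vertices with vertices of H, and an injective map φ from the path's edges
-- to edges of H (a bijection onto a subhypergraph) with e ⊆ φ(e).
ContainsBergeTightPath : ∀ {n k} → (r ℓ : ℕ) → UniformHypergraph n k → Set
ContainsBergeTightPath {n} r ℓ H =
  Σ (Fin ℓ → Fin n) λ v → Injective _≡_ _≡_ v ×
  Σ (Fin (ℓ ∸ r + 1) → Fin (length (edges H))) λ φ → Injective _≡_ _≡_ φ ×
  (∀ i j → InTightPathEdge r ℓ i j → v j ∈ lookup (edges H) (φ i))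

-- Write r = d + 1. Peel the hypergraph: as long as some d-tuple of vertices
-- lies in at least one but at most D = ℓ + 2 ^ ℓ of the remaining edges,
-- delete those edges. Each round deletes at most D edges and kills at least
-- one of the at most n ^ d tuples, so either at most D n ^ d edges are
-- deleted in total, or a nonempty core survives in which every d-tuple that
-- lies in an edge lies in more than D edges. In the core a Berge tight path
-- grows greedily: the first d vertices of the current path lie in more than
-- D core edges; at most ℓ of these are already used and at most 2 ^ ℓ lie
-- inside the current vertex set, so another one is new and brings a new
-- vertex, which is prepended to the path together with that edge.
module Submission where

open import Defs
open import Data.Nat using (ℕ; _≤_; _<_; _*_; _^_; _∸_)
open import Data.Product using (Σ)
open import Relation.Nullary using (¬_)

open import Data.Nat using (zero; suc; _+_; z≤n; s≤s)
open import Data.Nat.Properties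
open import Data.Nat.Induction using (<-wellFounded)
open import Induction.WellFounded using (Acc; acc)
open import Data.Bool using (Bool; true; false)
import Data.Bool.Properties as Bool
open import Data.Empty using (⊥-elim)
open import Data.Fin using (Fin; zero; suc; toℕ; inject≤; fromℕ<; cast; finToFun; funToFin)
open import Data.Fin.Properties
  using (any?; all?; toℕ-injective; toℕ-inject≤; toℕ-fromℕ<; toℕ-cast; toℕ<n; finToFun-funToFin)
open import Data.Fin.Subset using (Subset; ∣_∣; _⊆_; inside; outside; ⊥)
  renaming (_∈_ to _∈ₛ_; _∉_ to _∉ₛ_)
open import Data.Fin.Subset.Properties using (_∈?_; p⊆q⇒∣p∣≤∣q∣; ∣⊥∣≡0; drop-∷-⊆)
open import Data.List using (List; []; _∷_; length; filter; allFin; tabulate; lookup; _++_)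
open import Data.List.Properties using (length-filter; filter-notAll; length-tabulate; length-++)
open import Data.List.Relation.Unary.Any using (Any; here; there; index)
import Data.List.Relation.Unary.Any as Any
open import Data.List.Relation.Unary.Any.Properties using (lookup-index)
import Data.List.Relation.Unary.Any.Properties as Any
open import Data.List.Relation.Unary.All using (_∷_)
open import Data.List.Relation.Unary.AllPairs using ([]; _∷_)
import Data.List.Relation.Unary.All as All
open import Data.List.Relation.Unary.Unique.Propositional using (Unique)
import Data.List.Relation.Unary.Unique.Propositional.Properties as Unique
open import Data.List.Membership.Propositional using (_∈_; find; lose)
open import Data.List.Membership.Propositional.Properties
  using (∈-filter⁻; ∈-allFin; ∈-tabulate⁺; ∈-∃++; ∈-++⁻; ∈-++⁺ˡ; ∈-++⁺ʳ)
open import Data.Product using (∃; _×_; _,_; proj₁; proj₂)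
open import Data.Sum using (_⊎_; inj₁; inj₂)
open import Data.Vec using ([]; _∷_; _[_]≔_)
open import Data.Vec.Base using (here; there)
open import Data.Vec.Properties using (≡-dec)
open import Data.Vec.Functional using (Vector; head; tail)
import Data.Vec.Functional as Vector
open import Function using (_∘_)
open import Function.Definitions using (Injective)
open import Relation.Binary.PropositionalEquality
  using (_≡_; refl; sym; trans; cong; subst; subst₂; module ≡-Reasoning)
open import Relation.Nullary using (Dec; yes; no; ¬?)
open import Relation.Nullary.Decidable using (_×-dec_; decidable-stable)
open import Relation.Unary using (Pred; Decidable)
open import Relation.Unary.Properties using (∁?)

private
  variable
    n m : ℕ

module _ {a p} {A : Set a} {P : Pred A p} (P? : Decidable P) where

  length-filter+length-filter-∁ : ∀ xs →
    length (filter P? xs) + length (filter (∁? P?) xs) ≡ length xs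
  length-filter+length-filter-∁ [] = refl
  length-filter+length-filter-∁ (x ∷ xs) with P? x
  ... | yes _ = cong suc (length-filter+length-filter-∁ xs)
  ... | no _  = trans (+-suc _ _) (cong suc (length-filter+length-filter-∁ xs))

module _ {a p q} {A : Set a} {P : Pred A p} {Q : Pred A q}
         (P? : Decidable P) (Q? : Decidable Q) (P⇒Q : ∀ {x} → P x → Q x) where

  length-filter-mono : ∀ xs → length (filter P? xs) ≤ length (filter Q? xs)
  length-filter-mono [] = z≤n
  length-filter-mono (x ∷ xs) with P? x | Q? x
  ... | yes _  | yes _  = s≤s (length-filter-mono xs)
  ... | yes px | no ¬qx = ⊥-elim (¬qx (P⇒Q px))
  ... | no _   | yes _  = m≤n⇒m≤1+n (length-filter-mono xs)
  ... | no _   | no _   = length-filter-mono xs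

  length-filter-< : ∀ {t xs} → t ∈ xs → Q t → ¬ P t →
    length (filter P? xs) < length (filter Q? xs)
  length-filter-< {xs = x ∷ xs} (here refl) qt ¬pt with P? x | Q? x
  ... | yes pt | _      = ⊥-elim (¬pt pt)
  ... | no _   | yes _  = s≤s (length-filter-mono xs)
  ... | no _   | no ¬qt = ⊥-elim (¬qt qt)
  length-filter-< {xs = x ∷ xs} (there t∈) qt ¬pt with P? x | Q? x
  ... | yes _  | yes _  = s≤s (length-filter-< t∈ qt ¬pt)
  ... | yes px | no ¬qx = ⊥-elim (¬qx (P⇒Q px))
  ... | no _   | yes _  = m≤n⇒m≤1+n (length-filter-< t∈ qt ¬pt)
  ... | no _   | no _   = length-filter-< t∈ qt ¬pt

unique⊆⇒length≤ : ∀ {a} {A : Set a} {xs ys : List A} →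
  Unique xs → (∀ {x} → x ∈ xs → x ∈ ys) → length xs ≤ length ys
unique⊆⇒length≤ {xs = []} _ _ = z≤n
unique⊆⇒length≤ {xs = x ∷ xs} (x∉xs ∷ uxs) xs⊆ys with ∈-∃++ (xs⊆ys (here refl))
... | as , bs , refl = begin
  suc (length xs)             ≤⟨ s≤s (unique⊆⇒length≤ uxs xs⊆as++bs) ⟩
  suc (length (as ++ bs))     ≡⟨ cong suc (length-++ as) ⟩
  suc (length as + length bs) ≡⟨ +-suc (length as) (length bs) ⟨
  length as + length (x ∷ bs) ≡⟨ length-++ as ⟨
  length (as ++ x ∷ bs)       ∎
  where
  open ≤-Reasoning
  xs⊆as++bs : ∀ {y} → y ∈ xs → y ∈ as ++ bs
  xs⊆as++bs y∈xs with ∈-++⁻ as (xs⊆ys (there y∈xs))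
  ... | inj₁ y∈as         = ∈-++⁺ˡ y∈as
  ... | inj₂ (here refl)  = ⊥-elim (All.lookup x∉xs y∈xs refl)
  ... | inj₂ (there y∈bs) = ∈-++⁺ʳ as y∈bs

cast-injective : ∀ {m m′} (eq : m ≡ m′) → Injective _≡_ _≡_ (cast eq)
cast-injective eq {a} {b} ca≡cb =
  toℕ-injective (trans (sym (toℕ-cast eq a)) (trans (cong toℕ ca≡cb) (toℕ-cast eq b)))

select : Bool → List (Subset (suc n)) → List (Subset n)
select b [] = []
select b ((c ∷ e) ∷ es) with c Bool.≟ b
... | yes _ = e ∷ select b es
... | no _  = select b es

∈-select⁻ : ∀ b {e} {es : List (Subset (suc n))} → e ∈ select b es → (b ∷ e) ∈ es
∈-select⁻ b {es = (c ∷ e) ∷ es} e∈ with c Bool.≟ b | e∈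
... | yes refl | here refl = here refl
... | yes refl | there e∈′ = there (∈-select⁻ b e∈′)
... | no _     | e∈′       = there (∈-select⁻ b e∈′)

select-unique : ∀ b {es : List (Subset (suc n))} → Unique es → Unique (select b es)
select-unique b {[]} [] = []
select-unique b {(c ∷ e) ∷ es} (e∉es ∷ ues) with c Bool.≟ b
... | yes refl = All.tabulate (λ f∈ e≡f → All.lookup e∉es (∈-select⁻ b f∈) (cong (b ∷_) e≡f))
                 ∷ select-unique b ues
... | no _     = select-unique b ues

length-select : (es : List (Subset (suc n))) → length (select true es) + length (select false es) ≡ length es
length-select [] = refl
length-select ((true ∷ e) ∷ es)  = cong suc (length-select es)
length-select ((false ∷ e) ∷ es) = trans (+-suc _ _) (cong suc (length-select es))

length-subsets≤2^∣∣ : (U : Subset n) {es : List (Subset n)} →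
  Unique es → (∀ {e} → e ∈ es → e ⊆ U) → length es ≤ 2 ^ ∣ U ∣
length-subsets≤2^∣∣ [] {[]} _ _ = z≤n
length-subsets≤2^∣∣ [] {_ ∷ []} _ _ = s≤s z≤n
length-subsets≤2^∣∣ [] {[] ∷ [] ∷ _} ((≢[] ∷ _) ∷ _) _ = ⊥-elim (≢[] refl)
length-subsets≤2^∣∣ (b ∷ U) {es} ues es⊆U = subst (_≤ 2 ^ ∣ b ∷ U ∣) (length-select es) (bound b es⊆U)
  where
  count : ∀ c → length (select c es) ≤ 2 ^ ∣ U ∣
  count c = length-subsets≤2^∣∣ U (select-unique c ues) (drop-∷-⊆ ∘ es⊆U ∘ ∈-select⁻ c)

  none-inside : (∀ {e} → e ∈ es → e ⊆ outside ∷ U) → select true es ≡ []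
  none-inside ⊆out with select true es in eq
  ... | [] = refl
  ... | e ∷ _ with ⊆out (∈-select⁻ true (subst (e ∈_) (sym eq) (here refl))) here
  ... | ()

  bound : ∀ c → (∀ {e} → e ∈ es → e ⊆ c ∷ U) →
    length (select true es) + length (select false es) ≤ 2 ^ ∣ c ∷ U ∣
  bound true _ = +-mono-≤ (count true) (subst (_ ≤_) (sym (+-identityʳ _)) (count false))
  bound false ⊆out rewrite none-inside ⊆out = count false

Escapes : Subset n → Subset n → Set
Escapes p q = ∃ λ x → x ∈ₛ p × x ∉ₛ q

escapes? : (p q : Subset n) → Dec (Escapes p q)
escapes? p q = any? λ x → x ∈? p ×-dec ¬? (x ∈? q)

¬escapes⇒⊆ : {p q : Subset n} → ¬ Escapes p q → p ⊆ q
¬escapes⇒⊆ {q = q} ¬esc {x} x∈p = decidable-stable (x ∈? q) (λ x∉q → ¬esc (x , x∈p , x∉q))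

∣∣<⇒escapes : {p q : Subset n} → ∣ q ∣ < ∣ p ∣ → Escapes p q
∣∣<⇒escapes {p = p} {q} ∣q∣<∣p∣ with escapes? p q
... | yes esc = esc
... | no ¬esc = ⊥-elim (<⇒≱ ∣q∣<∣p∣ (p⊆q⇒∣p∣≤∣q∣ (¬escapes⇒⊆ ¬esc)))

insert : Fin n → Subset n → Subset n
insert x p = p [ x ]≔ inside

x∈insert : ∀ (x : Fin n) p → x ∈ₛ insert x p
x∈insert zero    (_ ∷ p) = here
x∈insert (suc x) (_ ∷ p) = there (x∈insert x p)

p⊆insert : ∀ (x : Fin n) p → p ⊆ insert x p
p⊆insert zero    (_ ∷ p) here      = here
p⊆insert zero    (_ ∷ p) (there y) = there y
p⊆insert (suc x) (_ ∷ p) here      = here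
p⊆insert (suc x) (_ ∷ p) (there y) = there (p⊆insert x p y)

∣insert∣≤ : ∀ (x : Fin n) p → ∣ insert x p ∣ ≤ suc ∣ p ∣
∣insert∣≤ zero    (inside  ∷ p) = n≤1+n _
∣insert∣≤ zero    (outside ∷ p) = ≤-refl
∣insert∣≤ (suc x) (inside  ∷ p) = s≤s (∣insert∣≤ x p)
∣insert∣≤ (suc x) (outside ∷ p) = ∣insert∣≤ x p

image : Vector (Fin n) m → Subset n
image {m = zero}  _ = ⊥
image {m = suc m} w = insert (head w) (image (tail w))

∈-image : (w : Vector (Fin n) m) (j : Fin m) → w j ∈ₛ image w
∈-image w zero    = x∈insert (head w) (image (tail w))
∈-image w (suc j) = p⊆insert (head w) (image (tail w)) (∈-image (tail w) j)

∣image∣≤ : (w : Vector (Fin n) m) → ∣ image w ∣ ≤ m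
∣image∣≤ {n} {zero} _ = ≤-reflexive (∣⊥∣≡0 n)
∣image∣≤ {m = suc m} w = ≤-trans (∣insert∣≤ (head w) (image (tail w))) (s≤s (∣image∣≤ (tail w)))

∷-injective : ∀ {v} {w : Vector (Fin n) m} → v ∉ₛ image w → Injective _≡_ _≡_ w →
  Injective _≡_ _≡_ (v Vector.∷ w)
∷-injective _ _ {zero} {zero} _ = refl
∷-injective {w = w} v∉w _ {zero} {suc j} v≡wj =
  ⊥-elim (v∉w (subst (_∈ₛ image w) (sym v≡wj) (∈-image w j)))
∷-injective {w = w} v∉w _ {suc i} {zero} wi≡v =
  ⊥-elim (v∉w (subst (_∈ₛ image w) wi≡v (∈-image w i)))
∷-injective _ w-inj {suc i} {suc j} wi≡wj = cong suc (w-inj wi≡wj)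

choose-distinct : ∀ (h : Subset n) a → a ≤ ∣ h ∣ →
  Σ (Vector (Fin n) a) λ w → Injective _≡_ _≡_ w × (∀ j → w j ∈ₛ h)
choose-distinct h zero _ = Vector.[] , (λ { {()} }) , λ ()
choose-distinct h (suc a) a<∣h∣ with choose-distinct h a (<⇒≤ a<∣h∣)
... | w , w-inj , w∈h with ∣∣<⇒escapes {p = h} (≤-<-trans (∣image∣≤ w) a<∣h∣)
... | x , x∈h , x∉w = x Vector.∷ w , ∷-injective x∉w w-inj , ∷∈h
  where
  ∷∈h : ∀ j → (x Vector.∷ w) j ∈ₛ h
  ∷∈h zero    = x∈h
  ∷∈h (suc j) = w∈h j

-- A d-tuple of vertices is coded by its index in Fin (n ^ d) and decoded by
-- finToFun, so that all d-tuples are enumerated by allFin (n ^ d).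
module _ {n : ℕ} (d : ℕ) where

  Within : Fin (n ^ d) → Subset n → Set
  Within t e = ∀ j → finToFun {n} {d} t j ∈ₛ e

  within? : ∀ t e → Dec (Within t e)
  within? t e = all? λ j → finToFun {n} {d} t j ∈? e

  within-funToFin : ∀ {f : Fin d → Fin n} {e} → (∀ j → f j ∈ₛ e) → Within (funToFin f) e
  within-funToFin {f} f∈e j = subst (_∈ₛ _) (sym (finToFun-funToFin f j)) (f∈e j)

  funToFin-within : ∀ {f : Fin d → Fin n} {e} → Within (funToFin f) e → ∀ j → f j ∈ₛ e
  funToFin-within {f} within j = subst (_∈ₛ _) (finToFun-funToFin f j) (within j)

  degree : List (Subset n) → Fin (n ^ d) → ℕ
  degree E t = length (filter (within? t) E)

  Dense : ℕ → List (Subset n) → Set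
  Dense D E = ∀ t → Any (Within t) E → D < degree E t

  support : List (Subset n) → List (Fin (n ^ d))
  support E = filter (λ t → Any.any? (within? t) E) (allFin (n ^ d))

  length-support≤ : ∀ E → length (support E) ≤ n ^ d
  length-support≤ E = ≤-trans (length-filter _ (allFin (n ^ d))) (≤-reflexive (length-tabulate _))

  remove : Fin (n ^ d) → List (Subset n) → List (Subset n)
  remove t = filter (∁? (within? t))

  module _ {t : Fin (n ^ d)} {E : List (Subset n)} (t∈E : Any (Within t) E) where

    length-remove< : length (remove t E) < length E
    length-remove< = filter-notAll (∁? (within? t)) E (Any.map (λ w ¬w → ¬w w) t∈E)

    length-support-remove< : length (support (remove t E)) < length (support E)
    length-support-remove< =
      length-filter-< (λ s → Any.any? (within? s) (remove t E)) (λ s → Any.any? (within? s) E)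
        (Any.filter⁻ (∁? (within? t))) (∈-allFin t) t∈E
        (λ t∈E′ → let (e , e∈E′ , within) = find t∈E′ in proj₂ (∈-filter⁻ (∁? (within? t)) {xs = E} e∈E′) within)

  record DenseCore (D : ℕ) (E : List (Subset n)) : Set where
    field
      core        : List (Subset n)
      core-unique : Unique core
      core⊆E      : ∀ {e} → e ∈ core → e ∈ E
      seed        : Subset n
      seed∈core   : seed ∈ core
      core-dense  : Dense D core

  DenseCore-⊆ : ∀ {D E E′} → (∀ {e} → e ∈ E′ → e ∈ E) → DenseCore D E′ → DenseCore D E
  DenseCore-⊆ E′⊆E C = record
    { core = core ; core-unique = core-unique ; core⊆E = E′⊆E ∘ core⊆E
    ; seed = seed ; seed∈core = seed∈core ; core-dense = core-dense }
    where open DenseCore C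

  peel : ∀ D E → Unique E → length E ≤ D * length (support E) ⊎ DenseCore D E
  peel D E = peel-acc E (<-wellFounded (length E))
    where
    peel-acc : ∀ E → Acc _<_ (length E) → Unique E → length E ≤ D * length (support E) ⊎ DenseCore D E
    peel-acc [] _ _ = inj₁ z≤n
    peel-acc E@(h ∷ _) (acc rec) uE with any? (λ t → Any.any? (within? t) E ×-dec degree E t ≤? D)
    ... | no ¬low = inj₂ record
      { core = E ; core-unique = uE ; core⊆E = λ e∈E → e∈E ; seed = h ; seed∈core = here refl
      ; core-dense = λ t t∈E → ≰⇒> (λ low → ¬low (t , t∈E , low)) }
    ... | yes (t , t∈E , low)
      with peel-acc (remove t E) (rec (length-remove< t∈E)) (Unique.filter⁺ (∁? (within? t)) uE)
    ...   | inj₂ C = inj₂ (DenseCore-⊆ (proj₁ ∘ ∈-filter⁻ (∁? (within? t)) {xs = E}) C)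
    ...   | inj₁ sparse = inj₁ (begin
      length E                                   ≡⟨ length-filter+length-filter-∁ (within? t) E ⟨
      degree E t + length (remove t E)           ≤⟨ +-mono-≤ low sparse ⟩
      D + D * length (support (remove t E))      ≡⟨ *-suc D _ ⟨
      D * suc (length (support (remove t E)))    ≤⟨ *-monoʳ-≤ D (length-support-remove< t∈E) ⟩
      D * length (support E)                     ∎)
      where open ≤-Reasoning

  record TightPath (E : List (Subset n)) (q : ℕ) : Set where
    field
      vertex           : Vector (Fin n) (q + suc d)
      vertex-injective : Injective _≡_ _≡_ vertex
      edge             : Vector (Subset n) (suc q)
      edge-injective   : Injective _≡_ _≡_ edge
      edge∈E           : ∀ i → edge i ∈ E
      covers           : ∀ i j → toℕ i ≤ toℕ j → toℕ j < toℕ i + suc d → vertex j ∈ₛ edge i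

    d≤ : d ≤ q + suc d
    d≤ = ≤-trans (n≤1+n d) (m≤n+m (suc d) q)

    leadingTuple : Fin (n ^ d)
    leadingTuple = funToFin (vertex ∘ λ j → inject≤ j d≤)

    leadingTuple-within : Within leadingTuple (edge zero)
    leadingTuple-within = within-funToFin λ j →
      covers zero (inject≤ j d≤) z≤n
        (subst (_< suc d) (sym (toℕ-inject≤ j d≤)) (m<n⇒m<1+n (toℕ<n j)))

    Used : Subset n → Set
    Used e = ∃ λ i → edge i ≡ e

    used? : ∀ e → Dec (Used e)
    used? e = any? λ i → ≡-dec Bool._≟_ (edge i) e

  open TightPath

  trivialPath : ∀ {E h} → h ∈ E → suc d ≤ ∣ h ∣ → TightPath E 0
  trivialPath {h = h} h∈E d<∣h∣ with choose-distinct h (suc d) d<∣h∣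
  ... | w , w-inj , w∈h = record
    { vertex = w ; vertex-injective = w-inj
    ; edge = λ _ → h ; edge-injective = λ { {zero} {zero} _ → refl } ; edge∈E = λ _ → h∈E
    ; covers = λ { zero j _ _ → w∈h j } }

  record Extension {E q} (P : TightPath E q) : Set where
    field
      newEdge         : Subset n
      newEdge∈E       : newEdge ∈ E
      newEdge-unused  : ¬ Used P newEdge
      newEdge-within  : Within (leadingTuple P) newEdge
      newVertex       : Fin n
      newVertex∈      : newVertex ∈ₛ newEdge
      newVertex-fresh : newVertex ∉ₛ image (vertex P)

  prepend : ∀ {E q} (P : TightPath E q) → Extension P → TightPath E (suc q)
  prepend P X = record
    { vertex = newVertex Vector.∷ vertex P
    ; vertex-injective = ∷-injective newVertex-fresh (vertex-injective P)
    ; edge = newEdge Vector.∷ edge P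
    ; edge-injective = edge-injective′
    ; edge∈E = λ { zero → newEdge∈E ; (suc i) → edge∈E P i }
    ; covers = covers′ }
    where
    open Extension X

    edge-injective′ : Injective _≡_ _≡_ (newEdge Vector.∷ edge P)
    edge-injective′ {zero}  {zero}  _  = refl
    edge-injective′ {zero}  {suc j} eq = ⊥-elim (newEdge-unused (j , sym eq))
    edge-injective′ {suc i} {zero}  eq = ⊥-elim (newEdge-unused (i , eq))
    edge-injective′ {suc i} {suc j} eq = cong suc (edge-injective P eq)

    covers′ : ∀ i j → toℕ i ≤ toℕ j → toℕ j < toℕ i + suc d →
      (newVertex Vector.∷ vertex P) j ∈ₛ (newEdge Vector.∷ edge P) i
    covers′ zero    zero    _       _       = newVertex∈
    covers′ zero    (suc j) _       (s≤s j<d) =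
      subst (_∈ₛ newEdge)
        (cong (vertex P) (toℕ-injective (trans (toℕ-inject≤ _ (d≤ P)) (toℕ-fromℕ< j<d))))
        (funToFin-within newEdge-within (fromℕ< j<d))
    covers′ (suc i) (suc j) (s≤s i≤j) (s≤s j<i+d) = covers P i j i≤j j<i+d

  extension : ∀ {E q ℓ} → Unique E → Dense (ℓ + 2 ^ ℓ) E → q + suc d ≤ ℓ →
    (P : TightPath E q) → Extension P
  extension {E} {q} {ℓ} uE dense q+d≤ℓ P = extend (Any.any? fresh? candidates)
    where
    candidates : List (Subset n)
    candidates = filter (within? (leadingTuple P)) E

    Fresh : Subset n → Set
    Fresh e = ¬ Used P e × Escapes e (image (vertex P))

    fresh? : ∀ e → Dec (Fresh e)
    fresh? e = ¬? (used? P e) ×-dec escapes? e (image (vertex P))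

    unique-candidates : Unique candidates
    unique-candidates = Unique.filter⁺ (within? (leadingTuple P)) uE

    used≤ : length (filter (used? P) candidates) ≤ ℓ
    used≤ = begin
      length (filter (used? P) candidates)
        ≤⟨ unique⊆⇒length≤ (Unique.filter⁺ (used? P) unique-candidates) used∈edges ⟩
      length (tabulate (edge P))           ≡⟨ length-tabulate (edge P) ⟩
      suc q                                ≤⟨ s≤s (m≤m+n q d) ⟩
      suc q + d                            ≡⟨ +-suc q d ⟨
      q + suc d                            ≤⟨ q+d≤ℓ ⟩
      ℓ                                    ∎
      where
      open ≤-Reasoning
      used∈edges : ∀ {e} → e ∈ filter (used? P) candidates → e ∈ tabulate (edge P)
      used∈edges e∈ with proj₂ (∈-filter⁻ (used? P) {xs = candidates} e∈)
      ... | i , refl = ∈-tabulate⁺ {f = edge P} i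

    extend : Dec (Any Fresh candidates) → Extension P
    extend (yes fresh) with find fresh
    ... | e , e∈candidates , unused , v , v∈e , v∉P = record
      { newEdge = e ; newEdge∈E = e∈E ; newEdge-unused = unused ; newEdge-within = within
      ; newVertex = v ; newVertex∈ = v∈e ; newVertex-fresh = v∉P }
      where
      e∈E = proj₁ (∈-filter⁻ (within? (leadingTuple P)) {xs = E} e∈candidates)
      within = proj₂ (∈-filter⁻ (within? (leadingTuple P)) {xs = E} e∈candidates)
    extend (no ¬fresh) = ⊥-elim (<⇒≱ many few)
      where
      many : ℓ + 2 ^ ℓ < length candidates
      many = dense (leadingTuple P) (lose (edge∈E P zero) (leadingTuple-within P))

      unused⊆P : ∀ {e} → e ∈ filter (∁? (used? P)) candidates → e ⊆ image (vertex P)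
      unused⊆P e∈ = ¬escapes⇒⊆ λ escapes →
        let (e∈candidates , unused) = ∈-filter⁻ (∁? (used? P)) {xs = candidates} e∈
        in ¬fresh (lose e∈candidates (unused , escapes))

      unused≤ : length (filter (∁? (used? P)) candidates) ≤ 2 ^ ℓ
      unused≤ = ≤-trans
        (length-subsets≤2^∣∣ (image (vertex P)) (Unique.filter⁺ (∁? (used? P)) unique-candidates) unused⊆P)
        (^-monoʳ-≤ 2 (≤-trans (∣image∣≤ (vertex P)) q+d≤ℓ))

      few : length candidates ≤ ℓ + 2 ^ ℓ
      few = subst (_≤ ℓ + 2 ^ ℓ) (length-filter+length-filter-∁ (used? P) candidates)
        (+-mono-≤ used≤ unused≤)

  tightPath : ∀ {E h ℓ} → Unique E → Dense (ℓ + 2 ^ ℓ) E → h ∈ E → suc d ≤ ∣ h ∣ →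
    ∀ q → q + suc d ≤ ℓ → TightPath E q
  tightPath uE dense h∈E d<∣h∣ zero _ = trivialPath h∈E d<∣h∣
  tightPath uE dense h∈E d<∣h∣ (suc q) sq+d≤ℓ = prepend P (extension uE dense q+d≤ℓ P)
    where
    q+d≤ℓ = ≤-trans (n≤1+n _) sq+d≤ℓ
    P = tightPath uE dense h∈E d<∣h∣ q q+d≤ℓ

tightPath⇒Berge : ∀ {n k d ℓ E} (H : UniformHypergraph n k) → (∀ {e} → e ∈ E → e ∈ edges H) →
  suc d ≤ ℓ → TightPath d E (ℓ ∸ suc d) → ContainsBergeTightPath (suc d) ℓ H
tightPath⇒Berge {d = d} {ℓ} H E⊆H d<ℓ P = v , v-injective , φ , φ-injective , v∈φ
  where
  open TightPath P
  q = ℓ ∸ suc d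

  #vertices : ℓ ≡ q + suc d
  #vertices = sym (m∸n+n≡m d<ℓ)

  #edges : q + 1 ≡ suc q
  #edges = +-comm q 1

  v : Fin ℓ → Fin _
  v = vertex ∘ cast #vertices

  v-injective : Injective _≡_ _≡_ v
  v-injective = cast-injective #vertices ∘ vertex-injective

  edge∈H : ∀ i → edge i ∈ edges H
  edge∈H i = E⊆H (edge∈E i)

  φ : Fin (q + 1) → Fin (length (edges H))
  φ i = index (edge∈H (cast #edges i))

  φ-injective : Injective _≡_ _≡_ φ
  φ-injective {a} {b} φa≡φb = cast-injective #edges (edge-injective (begin
    edge (cast #edges a)                ≡⟨ lookup-index (edge∈H (cast #edges a)) ⟩
    lookup (edges H) (φ a)              ≡⟨ cong (lookup (edges H)) φa≡φb ⟩
    lookup (edges H) (φ b)              ≡⟨ lookup-index (edge∈H (cast #edges b)) ⟨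
    edge (cast #edges b)                ∎))
    where open ≡-Reasoning

  v∈φ : ∀ i j → InTightPathEdge (suc d) ℓ i j → v j ∈ₛ lookup (edges H) (φ i)
  v∈φ i j (i≤j , j<i+d) = subst (v j ∈ₛ_) (lookup-index (edge∈H (cast #edges i)))
    (covers (cast #edges i) (cast #vertices j)
      (subst₂ _≤_ (sym (toℕ-cast #edges i)) (sym (toℕ-cast #vertices j)) i≤j)
      (subst₂ _<_ (sym (toℕ-cast #vertices j)) (cong (_+ suc d) (sym (toℕ-cast #edges i))) j<i+d))

mainTheorem11 : (r k ℓ : ℕ) → 3 ≤ r → r < k → k < ℓ →
    Σ ℕ λ C → Σ ℕ λ N → (n : ℕ) → N ≤ n →
      (H : UniformHypergraph n k) → ¬ ContainsBergeTightPath r ℓ H →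
      numEdges H ≤ C * n ^ (r ∸ 1)
mainTheorem11 (suc d) k ℓ _ r<k k<ℓ = ℓ + 2 ^ ℓ , 0 , λ _ _ → bound
  where
  d<ℓ : suc d ≤ ℓ
  d<ℓ = <⇒≤ (<-trans r<k k<ℓ)

  bound : ∀ {n} (H : UniformHypergraph n k) → ¬ ContainsBergeTightPath (suc d) ℓ H →
    numEdges H ≤ (ℓ + 2 ^ ℓ) * n ^ d
  bound H noPath with peel d (ℓ + 2 ^ ℓ) (edges H) (distinct H)
  ... | inj₁ sparse = ≤-trans sparse (*-monoʳ-≤ (ℓ + 2 ^ ℓ) (length-support≤ d (edges H)))
  ... | inj₂ C = ⊥-elim (noPath (tightPath⇒Berge H core⊆E d<ℓ
          (tightPath d core-unique core-dense seed∈core d<∣seed∣ (ℓ ∸ suc d) (≤-reflexive (m∸n+n≡m d<ℓ)))))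
    where
    open DenseCore C
    d<∣seed∣ : suc d ≤ ∣ seed ∣
    d<∣seed∣ = subst (suc d ≤_) (sym (All.lookup (uniform H) (core⊆E seed∈core))) (<⇒≤ r<k)
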